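{- Let $F$ be a life-like freezing cellular automaton (on the triangular or square grid) and let $F^*$ be the life-like freezing rule (same grid) with $\mathcal{I}_{F^*}=\mathcal{I}_F\setminus\{|N(\cdot)|\}$, where $|N(\cdot)|$ is the number of neighbors of a cell ($3$ in the triangular grid, $4$ in the square grid). Let $x$ be a configuration and $u$ an inactive cell, and suppose there exists $k\in\mathcal{I}_{F^*}$ such that $\sum_{w\in N(u)}x_w\le k$. Then $u$ is stable for $x$ under rule $F$ if and only if $u$ is stable for $x$ under rule $F^*$.
   Context: Cells have two states, $0$ (inactive) and $1$ (active). In the triangular grid, $G(n)$ is a rhombus-shaped region of $2n^2$ triangular cells with periodic (torus) boundary, each cell having 3 neighbors (cells sharing an edge); in the square grid, $G(n)$ is the $n\times n$ torus, each cell having 4 neighbors (von Neumann neighborhood). $N(u)$ is the set of neighbors of $u$. A life-like freezing rule is determined by a set $\mathcal{I}$ of integers (for the rules considered, an interval $\{k_1,\dots,k_2\}$): $F(x)_u=1$ if $x_u=1$ or $\sum_{w\in N(u)}x_w\in\mathcal{I}$, and $0$ otherwise. A sequential update scheme is a map $\sigma:\mathbb{N}\to G(n)$ such that each consecutive block of $|G(n)|$ steps is a permutation of the cells; $F^{\sigma(0)}(x)=x$ and at time $t$ only cell $\sigma(t)$ is updated by the local rule. A cell $v$ is stable for $x$ under a rule if its state never changes under any sequential update scheme. -}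

module Defs where

open import Data.Nat using (ℕ; zero; suc; _+_; _*_; _≤_; _≡ᵇ_)
open import Data.Nat.DivMod using (_mod_)
open import Data.Fin using (Fin; toℕ) renaming (zero to fz; suc to fs)
open import Data.Fin.Properties as FinP using ()
open import Data.Bool using (Bool; true; false; _∨_; _∧_; not; if_then_else_)
open import Data.Product using (_×_; _,_; ∃)
open import Data.Product.Properties using (≡-dec)
open import Data.Vec using (Vec; []; _∷_; map; sum)
open import Relation.Binary.PropositionalEquality using (_≡_)
open import Relation.Binary.Definitions using (DecidableEquality)
open import Relation.Nullary using (does)
open import Function.Definitions using (Bijective)

inc : ∀ {n} → Fin n → Fin n
inc {suc m} i = suc (toℕ i) mod suc m

dec : ∀ {n} → Fin n → Fin n
dec {suc m} i = (toℕ i + m) mod suc m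

data Grid : Set where
  tri sq : Grid

-- tri: rhombus of n×n parallelograms, each split into a "lower" (0) and
-- "upper" (1) triangle: 2n² cells.  sq: n×n torus.
Cell : Grid → ℕ → Set
Cell tri n = Fin n × Fin n × Fin 2
Cell sq  n = Fin n × Fin n

size : Grid → ℕ → ℕ
size tri n = 2 * (n * n)
size sq  n = n * n

deg : Grid → ℕ
deg tri = 3
deg sq  = 4

nbrs : ∀ g {n} → Cell g n → Vec (Cell g n) (deg g)
nbrs tri (i , j , fz)    = (i , j , fs fz) ∷ (dec i , j , fs fz) ∷ (i , dec j , fs fz) ∷ []
nbrs tri (i , j , fs _)  = (i , j , fz) ∷ (inc i , j , fz) ∷ (i , inc j , fz) ∷ []
nbrs sq  (i , j)         = (inc i , j) ∷ (dec i , j) ∷ (i , inc j) ∷ (i , dec j) ∷ []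

-- sizes for which the grid is the paper's one (neighbours pairwise distinct,
-- so |N(u)| really is 3 resp. 4)
ValidSize : Grid → ℕ → Set
ValidSize tri n = 2 ≤ n
ValidSize sq  n = 3 ≤ n

cellEq : ∀ g {n} → DecidableEquality (Cell g n)
cellEq tri = ≡-dec FinP._≟_ (≡-dec FinP._≟_ FinP._≟_)
cellEq sq  = ≡-dec FinP._≟_ FinP._≟_

Config : Grid → ℕ → Set
Config g n = Cell g n → Bool

bit : Bool → ℕ
bit true  = 1
bit false = 0

activeSum : ∀ g {n} → Config g n → Cell g n → ℕ
activeSum g x u = sum (map (λ w → bit (x w)) (nbrs g u))

-- a rule is given by (the characteristic function of) its set 𝓘
RuleSet : Set
RuleSet = ℕ → Bool

IsLifeLikeInterval : Grid → RuleSet → Set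
IsLifeLikeInterval g I =
  ∃ λ k₁ → ∃ λ k₂ → k₂ ≤ deg g ×
    (∀ k → (I k ≡ true → k₁ ≤ k × k ≤ k₂) × (k₁ ≤ k × k ≤ k₂ → I k ≡ true))

Star : Grid → RuleSet → RuleSet
Star g I k = I k ∧ not (k ≡ᵇ deg g)

localF : ∀ g {n} → RuleSet → Config g n → Cell g n → Bool
localF g I x u = x u ∨ I (activeSum g x u)

step : ∀ g {n} → RuleSet → Config g n → Cell g n → Config g n
step g I x c v = if does (cellEq g c v) then localF g I x v else x v

IsSeqScheme : ∀ g n → (ℕ → Cell g n) → Set
IsSeqScheme g n σ =
  ∀ m → Bijective _≡_ _≡_ (λ (i : Fin (size g n)) → σ (m * size g n + toℕ i))

run : ∀ g {n} → RuleSet → (ℕ → Cell g n) → Config g n → ℕ → Config g n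
run g I σ x zero    = x
run g I σ x (suc t) = step g I (run g I σ x t) (σ t)

Stable : ∀ g n → RuleSet → Config g n → Cell g n → Set
Stable g n I x v =
  (σ : ℕ → Cell g n) → IsSeqScheme g n σ → ∀ t → run g I σ x t v ≡ x v

module Submission where

-- Run F and F* from x along the same update scheme.  The F-run is "shadowed" by
-- the F*-run: the two configurations agree except at cells that are inactive under F*
-- while all their neighbours are already active (Shadow).  Hence if u is stable under F
-- it is stable under F*, since at u the F*-run either copies the F-run or is inactive.
-- Conversely, if u becomes active under F at time t, then under F* all neighbours of u are
-- active at t.  The F*-neighbour count of u starts at most k and grows by at most one per
-- step (neighbours are distinct, Neighbourhood), so it passes through [k₁, k] ⊆ 𝓘_{F*}
-- (intermediate-value).  But a stable inactive cell never sees such a neighbourhood: the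
-- update of u in that block of the scheme can be moved to the right moment by swapping
-- steps inside the block, which keeps the scheme valid (Schedules) and, since updating u
-- changes nothing, keeps the run (Silence).

open import Defs
open import Data.Nat using (ℕ; zero; suc; _+_; _*_; _∸_; _≤_; _<_; z≤n; s≤s; NonZero)
open import Data.Nat.Properties
open import Data.Nat.DivMod
  using (_%_; _/_; _mod_; m≡m%n+[m/n]*n; [m+n]%n≡m%n; %-distribˡ-+; m%n%n≡m%n; m<n⇒m%n≡m;
         +-distrib-/-∣ˡ; m*n/n≡m; m<n⇒m/n≡0; /-monoˡ-≤)
open import Data.Nat.Divisibility using (divides; >⇒∤; n∣m*n)
open import Data.Fin using (Fin; toℕ) renaming (zero to fz; suc to fs)
open import Data.Fin.Properties using (toℕ-fromℕ<; toℕ-injective; toℕ<n)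
open import Data.Bool using (Bool; true; false; _∨_; _∧_; not)
open import Data.Bool.Properties using (∧-zeroʳ; ∧-identityʳ; ∨-zeroʳ)
open import Data.Product using (_×_; _,_; ∃; proj₁; proj₂)
open import Data.Sum using (_⊎_; inj₁; inj₂)
open import Data.Vec using (Vec; []; _∷_; map; sum)
open import Data.Vec.Relation.Unary.Any using (here; there)
open import Data.Vec.Relation.Unary.All using ([]; _∷_)
import Data.Vec.Relation.Unary.All as All
open import Data.Vec.Membership.Propositional using (_∈_)
open import Data.Vec.Relation.Unary.Unique.Propositional using (Unique; []; _∷_)
open import Function using (_∘_)
open import Function.Definitions using (Bijective)
open import Function.Bundles using (_⇔_; mk⇔)
open import Relation.Binary.PropositionalEquality
open import Relation.Binary.Definitions using (DecidableEquality)
open import Relation.Nullary using (yes; no; contradiction)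
open import Relation.Nullary.Decidable using (dec-true; dec-false)

module Counting {A : Set} where

  count : ∀ {d} → (A → Bool) → Vec A d → ℕ
  count f ws = sum (map (λ w → bit (f w)) ws)

  bit≤1 : ∀ b → bit b ≤ 1
  bit≤1 true  = s≤s z≤n
  bit≤1 false = z≤n

  count-cong : ∀ {d} {f f' : A → Bool} (ws : Vec A d) →
    (∀ {w} → w ∈ ws → f w ≡ f' w) → count f ws ≡ count f' ws
  count-cong []       _  = refl
  count-cong (w ∷ ws) eq = cong₂ _+_ (cong bit (eq (here refl))) (count-cong ws (eq ∘ there))

  count≤length : ∀ {d} (f : A → Bool) (ws : Vec A d) → count f ws ≤ d
  count≤length f []       = z≤n
  count≤length f (w ∷ ws) = +-mono-≤ (bit≤1 (f w)) (count≤length f ws)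

  count≡length⇒all : ∀ {d} (f : A → Bool) (ws : Vec A d) →
    count f ws ≡ d → ∀ {w} → w ∈ ws → f w ≡ true
  count≡length⇒all f (v ∷ ws) full w∈ with f v in fv
  ... | false = contradiction full (<⇒≢ (s≤s (count≤length f ws)))
  ... | true with w∈
  ...   | here refl  = fv
  ...   | there w∈ws = count≡length⇒all f ws (suc-injective full) w∈ws

  all⇒count≡length : ∀ {d} (f : A → Bool) (ws : Vec A d) →
    (∀ {w} → w ∈ ws → f w ≡ true) → count f ws ≡ d
  all⇒count≡length f []       _   = refl
  all⇒count≡length f (w ∷ ws) all rewrite all (here refl) =
    cong suc (all⇒count≡length f ws (all ∘ there))

  count-update : DecidableEquality A → ∀ {d} {f f' : A → Bool} (c : A) {ws : Vec A d} →
    Unique ws → (∀ {v} → c ≢ v → f' v ≡ f v) → count f' ws ≤ suc (count f ws)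
  count-update _≟_ c [] _ = z≤n
  count-update _≟_ {f = f} {f'} c {w ∷ ws} (w∉ws ∷ unique) agree with c ≟ w
  ... | yes refl = +-mono-≤ (bit≤1 (f' c)) (begin
        count f' ws            ≡⟨ count-cong ws (λ v∈ → agree (All.lookup w∉ws v∈)) ⟩
        count f ws             ≤⟨ m≤n+m _ (bit (f c)) ⟩
        bit (f c) + count f ws ∎)
    where open ≤-Reasoning
  ... | no c≢w = begin
        bit (f' w) + count f' ws      ≡⟨ cong (λ b → bit b + count f' ws) (agree c≢w) ⟩
        bit (f w) + count f' ws       ≤⟨ +-monoʳ-≤ (bit (f w)) (count-update _≟_ c unique agree) ⟩
        bit (f w) + suc (count f ws)  ≡⟨ +-suc (bit (f w)) (count f ws) ⟩
        suc (count f (w ∷ ws))        ∎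
    where open ≤-Reasoning

module Torus {m : ℕ} where

  private
    N : ℕ
    N = suc m

  toℕ-inc : (i : Fin N) → toℕ (inc i) ≡ suc (toℕ i) % N
  toℕ-inc i = toℕ-fromℕ< _

  toℕ-dec : (i : Fin N) → toℕ (dec i) ≡ (toℕ i + m) % N
  toℕ-dec i = toℕ-fromℕ< _

  mod-absorbˡ : ∀ a b → (a % N + b) % N ≡ (a + b) % N
  mod-absorbˡ a b = begin
    (a % N + b) % N           ≡⟨ %-distribˡ-+ (a % N) b N ⟩
    (a % N % N + b % N) % N   ≡⟨ cong (λ z → (z + b % N) % N) (m%n%n≡m%n a N) ⟩
    (a % N + b % N) % N       ≡⟨ %-distribˡ-+ a b N ⟨
    (a + b) % N               ∎
    where open ≡-Reasoning

  mod-absorbʳ : ∀ a b → (a + b % N) % N ≡ (a + b) % N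
  mod-absorbʳ a b = begin
    (a + b % N) % N   ≡⟨ cong (_% N) (+-comm a (b % N)) ⟩
    (b % N + a) % N   ≡⟨ mod-absorbˡ b a ⟩
    (b + a) % N       ≡⟨ cong (_% N) (+-comm b a) ⟩
    (a + b) % N       ∎
    where open ≡-Reasoning

  full-turn : (i : Fin N) → suc (toℕ i + m) % N ≡ toℕ i
  full-turn i = begin
    suc (toℕ i + m) % N  ≡⟨ cong (_% N) (+-suc (toℕ i) m) ⟨
    (toℕ i + N) % N      ≡⟨ [m+n]%n≡m%n (toℕ i) N ⟩
    toℕ i % N            ≡⟨ m<n⇒m%n≡m (toℕ<n i) ⟩
    toℕ i                ∎
    where open ≡-Reasoning

  inc-dec : (i : Fin N) → inc (dec i) ≡ i
  inc-dec i = toℕ-injective (begin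
    toℕ (inc (dec i))          ≡⟨ toℕ-inc (dec i) ⟩
    suc (toℕ (dec i)) % N      ≡⟨ cong (λ z → suc z % N) (toℕ-dec i) ⟩
    suc ((toℕ i + m) % N) % N  ≡⟨ mod-absorbʳ 1 (toℕ i + m) ⟩
    suc (toℕ i + m) % N        ≡⟨ full-turn i ⟩
    toℕ i                      ∎)
    where open ≡-Reasoning

  dec-inc : (i : Fin N) → dec (inc i) ≡ i
  dec-inc i = toℕ-injective (begin
    toℕ (dec (inc i))          ≡⟨ toℕ-dec (inc i) ⟩
    (toℕ (inc i) + m) % N      ≡⟨ cong (λ z → (z + m) % N) (toℕ-inc i) ⟩
    (suc (toℕ i) % N + m) % N  ≡⟨ mod-absorbˡ (suc (toℕ i)) m ⟩
    suc (toℕ i + m) % N        ≡⟨ full-turn i ⟩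
    toℕ i                      ∎)
    where open ≡-Reasoning

  -- moving 0 < k < N steps along the cycle never returns to the start, as N ∤ k
  shift-mod-≢ : ∀ k t → .{{NonZero k}} → k < N → (k + t) % N ≢ t
  shift-mod-≢ k t k<N eq = >⇒∤ k<N (divides ((k + t) / N) (+-cancelˡ-≡ t _ _ (begin
    t + k                          ≡⟨ +-comm t k ⟩
    k + t                          ≡⟨ m≡m%n+[m/n]*n (k + t) N ⟩
    (k + t) % N + (k + t) / N * N  ≡⟨ cong (_+ (k + t) / N * N) eq ⟩
    t + (k + t) / N * N            ∎)))
    where open ≡-Reasoning

  inc-≢ : 2 ≤ N → (i : Fin N) → inc i ≢ i
  inc-≢ 2≤N i eq = shift-mod-≢ 1 (toℕ i) 2≤N (trans (sym (toℕ-inc i)) (cong toℕ eq))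

  dec-≢ : 2 ≤ N → (i : Fin N) → dec i ≢ i
  dec-≢ 2≤N i eq = inc-≢ 2≤N i (trans (cong inc (sym eq)) (inc-dec i))

  inc-≢-dec : 3 ≤ N → (i : Fin N) → inc i ≢ dec i
  inc-≢-dec 3≤N i eq = shift-mod-≢ 2 (toℕ i) 3≤N (begin
    suc (suc (toℕ i)) % N        ≡⟨ mod-absorbʳ 1 (suc (toℕ i)) ⟨
    suc (suc (toℕ i) % N) % N    ≡⟨ cong (λ z → suc z % N) (toℕ-inc i) ⟨
    suc (toℕ (inc i)) % N        ≡⟨ toℕ-inc (inc i) ⟨
    toℕ (inc (inc i))            ≡⟨ cong (toℕ ∘ inc) eq ⟩
    toℕ (inc (dec i))            ≡⟨ cong toℕ (inc-dec i) ⟩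
    toℕ i                        ∎)
    where open ≡-Reasoning

module Neighbourhood where
  open Torus

  nbr-sym : ∀ g {n} {c w : Cell g n} → w ∈ nbrs g c → c ∈ nbrs g w
  nbr-sym tri {suc _} {i , j , fz} (here refl)                 = here refl
  nbr-sym tri {suc _} {i , j , fz} (there (here refl))         =
    there (here (cong (_, j , fz) (sym (inc-dec i))))
  nbr-sym tri {suc _} {i , j , fz} (there (there (here refl))) =
    there (there (here (cong (λ b → i , b , fz) (sym (inc-dec j)))))
  nbr-sym tri {suc _} {i , j , fs fz} (here refl)                 = here refl
  nbr-sym tri {suc _} {i , j , fs fz} (there (here refl))         =
    there (here (cong (_, j , fs fz) (sym (dec-inc i))))
  nbr-sym tri {suc _} {i , j , fs fz} (there (there (here refl))) =
    there (there (here (cong (λ b → i , b , fs fz) (sym (dec-inc j)))))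
  nbr-sym sq  {suc _} {i , j} (here refl)                         =
    there (here (cong (_, j) (sym (dec-inc i))))
  nbr-sym sq  {suc _} {i , j} (there (here refl))                 =
    here (cong (_, j) (sym (inc-dec i)))
  nbr-sym sq  {suc _} {i , j} (there (there (here refl)))         =
    there (there (there (here (cong (i ,_) (sym (dec-inc j))))))
  nbr-sym sq  {suc _} {i , j} (there (there (there (here refl)))) =
    there (there (here (cong (i ,_) (sym (inc-dec j)))))

  nbrs-unique : ∀ g {n} → ValidSize g n → (c : Cell g n) → Unique (nbrs g c)
  nbrs-unique tri {suc _} 2≤n (i , j , fz) =
      (dec-≢ 2≤n i ∘ sym ∘ cong proj₁ ∷ dec-≢ 2≤n j ∘ sym ∘ cong (proj₁ ∘ proj₂) ∷ [])
    ∷ (dec-≢ 2≤n i ∘ cong proj₁ ∷ [])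
    ∷ [] ∷ []
  nbrs-unique tri {suc _} 2≤n (i , j , fs fz) =
      (inc-≢ 2≤n i ∘ sym ∘ cong proj₁ ∷ inc-≢ 2≤n j ∘ sym ∘ cong (proj₁ ∘ proj₂) ∷ [])
    ∷ (inc-≢ 2≤n i ∘ cong proj₁ ∷ [])
    ∷ [] ∷ []
  nbrs-unique sq {suc _} 3≤n (i , j) =
      (inc-≢-dec 3≤n i ∘ cong proj₁ ∷ inc-≢ 2≤n i ∘ cong proj₁ ∷ inc-≢ 2≤n i ∘ cong proj₁ ∷ [])
    ∷ (dec-≢ 2≤n i ∘ cong proj₁ ∷ dec-≢ 2≤n i ∘ cong proj₁ ∷ [])
    ∷ (inc-≢-dec 3≤n j ∘ cong proj₂ ∷ [])
    ∷ [] ∷ []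
    where 2≤n = ≤-trans (n≤1+n 2) 3≤n

module Dynamics (g : Grid) {n : ℕ} where
  open Counting

  localF-active : ∀ J (y : Config g n) {c} → y c ≡ true → localF g J y c ≡ true
  localF-active J y yc = cong (_∨ J (activeSum g y _)) yc

  localF-inactive : ∀ J (y : Config g n) {c} → y c ≡ false → localF g J y c ≡ J (activeSum g y c)
  localF-inactive J y yc = cong (_∨ J (activeSum g y _)) yc

  step-self : ∀ J (y : Config g n) c → step g J y c c ≡ localF g J y c
  step-self J y c with cellEq g c c
  ... | yes _  = refl
  ... | no c≢c = contradiction refl c≢c

  step-other : ∀ J (y : Config g n) {c v} → c ≢ v → step g J y c v ≡ y v
  step-other J y {c} {v} c≢v with cellEq g c v
  ... | yes c≡v = contradiction c≡v c≢v
  ... | no _    = refl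

  step-frozen : ∀ J (y : Config g n) c {v} → y v ≡ true → step g J y c v ≡ true
  step-frozen J y c {v} yv with cellEq g c v
  ... | yes refl = localF-active J y yv
  ... | no _     = yv

  activeSum-cong : {y y' : Config g n} → y ≗ y' → ∀ w → activeSum g y w ≡ activeSum g y' w
  activeSum-cong y≗y' w = count-cong (nbrs g w) (λ {v} _ → y≗y' v)

  step-cong : ∀ J {y y' : Config g n} c → y ≗ y' → step g J y c ≗ step g J y' c
  step-cong J c y≗y' v with cellEq g c v
  ... | yes refl = cong₂ _∨_ (y≗y' c) (cong J (activeSum-cong y≗y' c))
  ... | no _     = y≗y' v

  activeSum-step : ValidSize g n → ∀ J (y : Config g n) c u →
    activeSum g (step g J y c) u ≤ suc (activeSum g y u)
  activeSum-step valid J y c u =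
    count-update (cellEq g) c (Neighbourhood.nbrs-unique g valid u) (step-other J y)

  run-prefix : ∀ J (x : Config g n) σ σ' t → (∀ i → i < t → σ i ≡ σ' i) →
    run g J σ x t ≡ run g J σ' x t
  run-prefix J x σ σ' zero    _     = refl
  run-prefix J x σ σ' (suc t) agree =
    cong₂ (step g J) (run-prefix J x σ σ' t (λ i i<t → agree i (m<n⇒m<1+n i<t))) (agree t ≤-refl)

  run-suffix : ∀ J (x : Config g n) σ σ' p → (∀ i → p ≤ i → σ i ≡ σ' i) →
    run g J σ x p ≗ run g J σ' x p → ∀ t → p ≤ t → run g J σ x t ≗ run g J σ' x t
  run-suffix J x σ σ' p agree meet t p≤t with m≤n⇒m<n∨m≡n p≤t
  ... | inj₂ refl = meet
  run-suffix J x σ σ' p agree meet (suc t) _ | inj₁ (s≤s p≤t) = λ v → begin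
    step g J (run g J σ x t) (σ t) v   ≡⟨ step-cong J (σ t) (run-suffix J x σ σ' p agree meet t p≤t) v ⟩
    step g J (run g J σ' x t) (σ t) v  ≡⟨ cong (λ c → step g J (run g J σ' x t) c v) (agree t p≤t) ⟩
    step g J (run g J σ' x t) (σ' t) v ∎
    where open ≡-Reasoning

module Transposition where

  swap : ℕ → ℕ → ℕ → ℕ
  swap a b p with p ≟ a
  ... | yes _ = b
  ... | no _ with p ≟ b
  ...   | yes _ = a
  ...   | no _  = p

  swap-left : ∀ a b → swap a b a ≡ b
  swap-left a b with a ≟ a
  ... | yes _  = refl
  ... | no a≢a = contradiction refl a≢a

  swap-right : ∀ a b → swap a b b ≡ a
  swap-right a b with b ≟ a
  ... | yes b≡a = b≡a
  ... | no _ with b ≟ b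
  ...   | yes _  = refl
  ...   | no b≢b = contradiction refl b≢b

  swap-other : ∀ a b {p} → p ≢ a → p ≢ b → swap a b p ≡ p
  swap-other a b {p} p≢a p≢b with p ≟ a
  ... | yes p≡a = contradiction p≡a p≢a
  ... | no _ with p ≟ b
  ...   | yes p≡b = contradiction p≡b p≢b
  ...   | no _    = refl

  swap-involutive : ∀ a b p → swap a b (swap a b p) ≡ p
  swap-involutive a b p with p ≟ a
  ... | yes refl = swap-right p b
  ... | no p≢a with p ≟ b
  ...   | yes refl = swap-left a p
  ...   | no p≢b   = swap-other a b p≢a p≢b

-- Sequential update schemes with blocks of length N: time p lies in block p / N.
module Schedules (N : ℕ) .{{_ : NonZero N}} where
  open Transposition

  IsSchedule : {C : Set} → (ℕ → C) → Set
  IsSchedule σ = ∀ m → Bijective _≡_ _≡_ (λ (i : Fin N) → σ (m * N + toℕ i))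

  block-of : ∀ m (k : Fin N) → (m * N + toℕ k) / N ≡ m
  block-of m k = begin
    (m * N + toℕ k) / N    ≡⟨ +-distrib-/-∣ˡ (toℕ k) (n∣m*n m) ⟩
    m * N / N + toℕ k / N  ≡⟨ cong₂ _+_ (m*n/n≡m m N) (m<n⇒m/n≡0 (toℕ<n k)) ⟩
    m + 0                  ≡⟨ +-identityʳ m ⟩
    m                      ∎
    where open ≡-Reasoning

  in-block : ∀ m p → p / N ≡ m → m * N + toℕ (p mod N) ≡ p
  in-block m p refl = begin
    p / N * N + toℕ (p mod N) ≡⟨ cong (p / N * N +_) (toℕ-fromℕ< _) ⟩
    p / N * N + p % N         ≡⟨ +-comm (p / N * N) (p % N) ⟩
    p % N + p / N * N         ≡⟨ m≡m%n+[m/n]*n p N ⟨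
    p                         ∎
    where open ≡-Reasoning

  same-block-between : ∀ {a b c} → a ≤ b → b ≤ c → a / N ≡ c / N → a / N ≡ b / N × b / N ≡ c / N
  same-block-between {a} {b} {c} a≤b b≤c same =
      ≤-antisym a/N≤b/N (≤-trans b/N≤c/N (≤-reflexive (sym same)))
    , ≤-antisym b/N≤c/N (≤-trans (≤-reflexive (sym same)) a/N≤b/N)
    where
    a/N≤b/N = /-monoˡ-≤ N a≤b
    b/N≤c/N = /-monoˡ-≤ N b≤c

  reindex : {C : Set} (σ : ℕ → C) (π : ℕ → ℕ) → (∀ p → π (π p) ≡ p) → (∀ p → π p / N ≡ p / N) →
    IsSchedule σ → IsSchedule (σ ∘ π)
  reindex σ π involutive keeps-block sched m = injective , surjective
    where
    open ≡-Reasoning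

    pos : Fin N → ℕ
    pos k = m * N + toℕ k

    ρ : Fin N → Fin N
    ρ k = π (pos k) mod N

    π-pos : ∀ k → pos (ρ k) ≡ π (pos k)
    π-pos k = in-block m (π (pos k)) (trans (keeps-block (pos k)) (block-of m k))

    injective : ∀ {k k'} → σ (π (pos k)) ≡ σ (π (pos k')) → k ≡ k'
    injective {k} {k'} eq = toℕ-injective (+-cancelˡ-≡ (m * N) _ _ (begin
      pos k          ≡⟨ involutive (pos k) ⟨
      π (π (pos k))  ≡⟨ cong π (trans (sym (π-pos k)) (trans (cong pos ρ-eq) (π-pos k'))) ⟩
      π (π (pos k')) ≡⟨ involutive (pos k') ⟩
      pos k'         ∎))
      where
      ρ-eq : ρ k ≡ ρ k'
      ρ-eq = proj₁ (sched m) (trans (cong σ (π-pos k)) (trans eq (cong σ (sym (π-pos k')))))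

    surjective : ∀ c → ∃ λ k → ∀ {k'} → k' ≡ k → σ (π (pos k')) ≡ c
    surjective c with proj₂ (sched m) c
    ... | k , hits = ρ k , λ { refl → begin
      σ (π (pos (ρ k)))  ≡⟨ cong (σ ∘ π) (π-pos k) ⟩
      σ (π (π (pos k)))  ≡⟨ cong σ (involutive (pos k)) ⟩
      σ (pos k)          ≡⟨ hits refl ⟩
      c                  ∎ }

  swap-block : ∀ {a b} → a / N ≡ b / N → ∀ p → swap a b p / N ≡ p / N
  swap-block {a} {b} same p with p ≟ a
  ... | yes refl = sym same
  ... | no _ with p ≟ b
  ...   | yes refl = same
  ...   | no _     = refl

  swap-schedule : {C : Set} (σ : ℕ → C) {a b : ℕ} → a / N ≡ b / N →
    IsSchedule σ → IsSchedule (σ ∘ swap a b)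
  swap-schedule σ {a} {b} same = reindex σ (swap a b) (swap-involutive a b) (swap-block same)

module StarRule (g : Grid) (I : RuleSet) where

  Star-deg : Star g I (deg g) ≡ false
  Star-deg = trans (cong (λ b → I (deg g) ∧ not b) (dec-true (deg g ≟ deg g) refl)) (∧-zeroʳ _)

  Star-agrees : ∀ {k} → k ≢ deg g → Star g I k ≡ I k
  Star-agrees {k} k≢deg = trans (cong (λ b → I k ∧ not b) (dec-false (k ≟ deg g) k≢deg)) (∧-identityʳ _)

  Star⊆I : ∀ {k} → Star g I k ≡ true → I k ≡ true
  Star⊆I {k} k∈ with I k
  ... | true  = refl
  ... | false = k∈

  Star-interval : IsLifeLikeInterval g I → ∀ {k} → Star g I k ≡ true →
    ∃ λ k₁ → k₁ ≤ k × k < deg g × (∀ {s} → k₁ ≤ s → s ≤ k → Star g I s ≡ true)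
  Star-interval (k₁ , k₂ , k₂≤deg , member) {k} k∈ = k₁ , k₁≤k , k<deg , filled
    where
    k₁≤k = proj₁ (proj₁ (member k) (Star⊆I k∈))
    k≤k₂ = proj₂ (proj₁ (member k) (Star⊆I k∈))

    k<deg : k < deg g
    k<deg = ≤∧≢⇒< (≤-trans k≤k₂ k₂≤deg) (λ { refl → contradiction (trans (sym k∈) Star-deg) λ () })

    filled : ∀ {s} → k₁ ≤ s → s ≤ k → Star g I s ≡ true
    filled {s} k₁≤s s≤k = trans (Star-agrees (<⇒≢ (≤-<-trans s≤k k<deg)))
                                (proj₂ (member s) (k₁≤s , ≤-trans s≤k k≤k₂))

module Shadow (g : Grid) {n : ℕ} (I : RuleSet) where
  open Counting
  open Dynamics g
  open StarRule g I

  Saturated : Config g n → Cell g n → Set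
  Saturated z v = ∀ {w} → w ∈ nbrs g v → z w ≡ true

  saturated-step : ∀ J (z : Config g n) c {v} → Saturated z v → Saturated (step g J z c) v
  saturated-step J z c sat w∈ = step-frozen J z c (sat w∈)

  saturated-stays-off : ∀ (z : Config g n) {v} → z v ≡ false → Saturated z v →
    localF g (Star g I) z v ≡ false
  saturated-stays-off z {v} zv sat =
    trans (cong₂ (λ b s → b ∨ Star g I s) zv (all⇒count≡length z (nbrs g v) sat)) Star-deg

  Shadows : Config g n → Config g n → Set
  Shadows y z = ∀ v → y v ≡ z v ⊎ (z v ≡ false × Saturated z v)

  -- an inactive cell of z has no saturated neighbour (by symmetry), so y and z agree around it
  shadow-sum : ∀ {y z} → Shadows y z → ∀ {c} → z c ≡ false → activeSum g y c ≡ activeSum g z c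
  shadow-sum {y} {z} sh {c} zc = count-cong (nbrs g c) agree
    where
    agree : ∀ {w} → w ∈ nbrs g c → y w ≡ z w
    agree {w} w∈ with sh w
    ... | inj₁ same      = same
    ... | inj₂ (_ , sat) = contradiction (trans (sym (sat (Neighbourhood.nbr-sym g w∈))) zc) λ ()

  shadow-step : ∀ {y z} → Shadows y z → ∀ c → Shadows (step g I y c) (step g (Star g I) z c)
  shadow-step {y} {z} sh c v with cellEq g c v
  ... | no _ = kept (sh v)
    where
    kept : y v ≡ z v ⊎ (z v ≡ false × Saturated z v) →
      y v ≡ z v ⊎ (z v ≡ false × Saturated (step g (Star g I) z c) v)
    kept (inj₁ same)       = inj₁ same
    kept (inj₂ (zv , sat)) = inj₂ (zv , saturated-step (Star g I) z c sat)
  ... | yes refl = updated (sh c)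
    where
    now-saturated : z c ≡ false → Saturated z c →
      localF g I y c ≡ localF g (Star g I) z c ⊎
      (localF g (Star g I) z c ≡ false × Saturated (step g (Star g I) z c) c)
    now-saturated zc sat = inj₂ (saturated-stays-off z zc sat , saturated-step (Star g I) z c sat)

    updated : y c ≡ z c ⊎ (z c ≡ false × Saturated z c) →
      localF g I y c ≡ localF g (Star g I) z c ⊎
      (localF g (Star g I) z c ≡ false × Saturated (step g (Star g I) z c) c)
    updated (inj₂ (zc , sat)) = now-saturated zc sat
    updated (inj₁ same) = by-state (z c) refl
      where
      -- the two rules only disagree on a full neighbourhood, which makes c saturated
      by-state : ∀ b → z c ≡ b →
        localF g I y c ≡ localF g (Star g I) z c ⊎
        (localF g (Star g I) z c ≡ false × Saturated (step g (Star g I) z c) c)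
      by-state true  zc =
        inj₁ (trans (localF-active I y (trans same zc)) (sym (localF-active (Star g I) z zc)))
      by-state false zc with activeSum g z c ≟ deg g
      ... | yes full    = now-saturated zc (count≡length⇒all z (nbrs g c) full)
      ... | no not-full = inj₁ (begin
            localF g I y c              ≡⟨ localF-inactive I y (trans same zc) ⟩
            I (activeSum g y c)         ≡⟨ cong I (shadow-sum sh zc) ⟩
            I (activeSum g z c)         ≡⟨ Star-agrees not-full ⟨
            Star g I (activeSum g z c)  ≡⟨ localF-inactive (Star g I) z zc ⟨
            localF g (Star g I) z c     ∎)
        where open ≡-Reasoning

  shadow-run : ∀ σ (x : Config g n) t → Shadows (run g I σ x t) (run g (Star g I) σ x t)
  shadow-run σ x zero    v = inj₁ refl
  shadow-run σ x (suc t)   = shadow-step (shadow-run σ x t) (σ t)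

intermediate-value : (s : ℕ → ℕ) {k₁ k : ℕ} → s 0 ≤ k → k₁ ≤ k → (∀ t → s (suc t) ≤ suc (s t)) →
  ∀ t → k₁ ≤ s t → ∃ λ q → k₁ ≤ s q × s q ≤ k
intermediate-value s s0≤k k₁≤k climb zero    k₁≤s = 0 , k₁≤s , s0≤k
intermediate-value s s0≤k k₁≤k climb (suc t) k₁≤s with _ ≤? s t
... | yes k₁≤st = intermediate-value s s0≤k k₁≤k climb t k₁≤st
... | no  k₁≰st = suc t , k₁≤s , ≤-trans (climb t) (≤-trans (≰⇒> k₁≰st) k₁≤k)

module Silence (g : Grid) (n : ℕ) .{{_ : NonZero (size g n)}} (J : RuleSet) (x : Config g n)
               (u : Cell g n) (inactive : x u ≡ false) (stable : Stable g n J x u) where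
  open Dynamics g
  open Transposition
  open Schedules (size g n)

  private
    N : ℕ
    N = size g n

    conf : (ℕ → Cell g n) → ℕ → Config g n
    conf σ t = run g J σ x t

  -- updating u changes nothing, since u keeps its state
  idle : ∀ σ → IsSeqScheme g n σ → ∀ {a} → σ a ≡ u → conf σ (suc a) ≗ conf σ a
  idle σ sched {a} σa≡u v with cellEq g u v
  ... | yes refl = trans (stable σ sched (suc a)) (sym (stable σ sched a))
  ... | no u≢v   = trans (cong (λ c → step g J (conf σ a) c v) σa≡u) (step-other J (conf σ a) u≢v)

  no-fire : ∀ σ → IsSeqScheme g n σ → ∀ {a} → σ a ≡ u → J (activeSum g (conf σ a) u) ≡ false
  no-fire σ sched {a} σa≡u with J (activeSum g (conf σ a) u) in fires
  ... | false = refl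
  ... | true  = contradiction (trans (sym activated) (trans (stable σ sched (suc a)) inactive)) λ ()
    where
    open ≡-Reasoning
    activated : conf σ (suc a) u ≡ true
    activated = begin
      step g J (conf σ a) (σ a) u                ≡⟨ cong (λ c → step g J (conf σ a) c u) σa≡u ⟩
      step g J (conf σ a) u u                    ≡⟨ step-self J (conf σ a) u ⟩
      conf σ a u ∨ J (activeSum g (conf σ a) u)  ≡⟨ cong (conf σ a u ∨_) fires ⟩
      conf σ a u ∨ true                          ≡⟨ ∨-zeroʳ _ ⟩
      true                                       ∎

  postpone : ∀ σ a → IsSeqScheme g n σ → σ a ≡ u → a / N ≡ suc a / N →
    IsSeqScheme g n (σ ∘ swap a (suc a)) × (σ ∘ swap a (suc a)) (suc a) ≡ u ×
    (∀ t → 2 + a ≤ t → conf (σ ∘ swap a (suc a)) t ≗ conf σ t)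
  postpone σ a sched σa≡u same = sched′ , σ′a+1≡u , run-suffix J x σ′ σ (2 + a) later meet
    where
    open ≡-Reasoning
    σ′ = σ ∘ swap a (suc a)
    sched′ = swap-schedule σ same sched
    σ′a+1≡u = trans (cong σ (swap-right a (suc a))) σa≡u

    earlier : ∀ i → i < a → σ′ i ≡ σ i
    earlier i i<a = cong σ (swap-other a (suc a) (<⇒≢ i<a) (<⇒≢ (m<n⇒m<1+n i<a)))

    later : ∀ i → 2 + a ≤ i → σ′ i ≡ σ i
    later i a+2≤i = cong σ (swap-other a (suc a) (λ { refl → 1+n≰n (m<n⇒m<1+n a+2≤i) })
                                                   (λ { refl → 1+n≰n a+2≤i }))

    -- σ′ performs σ's update at a + 1 first and then the idle update of u
    meet : conf σ′ (2 + a) ≗ conf σ (2 + a)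
    meet v = begin
      conf σ′ (2 + a) v                  ≡⟨ idle σ′ sched′ σ′a+1≡u v ⟩
      step g J (conf σ′ a) (σ′ a) v      ≡⟨ cong₂ (λ y c → step g J y c v)
                                              (run-prefix J x σ′ σ a earlier) (cong σ (swap-left a (suc a))) ⟩
      step g J (conf σ a) (σ (suc a)) v  ≡⟨ step-cong J (σ (suc a)) (idle σ sched σa≡u) v ⟨
      conf σ (2 + a) v                   ∎

  delay : ∀ d {a b} → d + a ≡ b → ∀ σ → IsSeqScheme g n σ → σ a ≡ u → a / N ≡ b / N →
    ∃ λ σ′ → IsSeqScheme g n σ′ × σ′ b ≡ u × conf σ′ b ≗ conf σ (suc b)
  delay zero refl σ sched σa≡u _ = σ , sched , σa≡u , λ v → sym (idle σ sched σa≡u v)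
  delay (suc d) {a} refl σ sched σa≡u same
    with same-block-between (n≤1+n a) (s≤s (m≤n+m a d)) same
  ... | next-same , rest-same with postpone σ a sched σa≡u next-same
  ...   | sched₁ , σ₁a+1≡u , agree
        with delay d (+-suc d a) (σ ∘ swap a (suc a)) sched₁ σ₁a+1≡u rest-same
  ...     | σ′ , sched′ , σ′≡u , sees = σ′ , sched′ , σ′≡u ,
            λ v → trans (sees v) (agree (2 + (d + a)) (s≤s (s≤s (m≤n+m a d))) v)

  -- a stable inactive cell never sees a neighbourhood that would activate it: otherwise
  -- move u's update in the current block to that moment
  silent : ∀ σ → IsSeqScheme g n σ → ∀ q → J (activeSum g (conf σ q) u) ≡ false
  silent σ sched q with proj₂ (sched (q / N)) u
  ... | k , hits = from-update (q / N * N + toℕ k) (hits refl) (sym (block-of (q / N) k))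
    where
    -- r is the time of q's block at which u is updated
    from-update : ∀ r → σ r ≡ u → q / N ≡ r / N → J (activeSum g (conf σ q) u) ≡ false
    from-update r σr≡u same with q ≤? r
    ... | yes q≤r = trans (cong (λ y → J (activeSum g y u)) unchanged)
                          (no-fire σ′ (swap-schedule σ same sched) {q} (trans (cong σ (swap-left q r)) σr≡u))
      where
      -- u's update is brought forward to time q, which leaves the run up to q unchanged
      σ′ = σ ∘ swap q r
      unchanged : conf σ q ≡ conf σ′ q
      unchanged = run-prefix J x σ σ′ q (λ i i<q →
        sym (cong σ (swap-other q r (<⇒≢ i<q) (<⇒≢ (<-≤-trans i<q q≤r)))))
    ... | no q≰r = via-delay (q ∸ suc r) (trans (sym (+-suc _ r)) (m∸n+n≡m (≰⇒> q≰r)))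
      where
      -- u's update is postponed to time d + r, just before q
      via-delay : ∀ d → suc (d + r) ≡ q → J (activeSum g (conf σ q) u) ≡ false
      via-delay d q≡ with delay d refl σ sched σr≡u
        (proj₁ (same-block-between (m≤n+m r d) (n≤1+n (d + r)) (trans (sym same) (cong (_/ N) (sym q≡)))))
      ... | σ′ , sched′ , σ′≡u , sees = begin
        J (activeSum g (conf σ q) u)              ≡⟨ cong (λ t → J (activeSum g (conf σ t) u)) q≡ ⟨
        J (activeSum g (conf σ (suc (d + r))) u)  ≡⟨ cong J (activeSum-cong sees u) ⟨
        J (activeSum g (conf σ′ (d + r)) u)       ≡⟨ no-fire σ′ sched′ σ′≡u ⟩
        false                                     ∎
        where open ≡-Reasoning

size-nonZero : ∀ g {n} → ValidSize g n → NonZero (size g n)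
size-nonZero tri {suc (suc _)}       _ = _
size-nonZero sq  {suc (suc (suc _))} _ = _
size-nonZero tri {suc zero}       (s≤s ())
size-nonZero sq  {suc zero}       (s≤s ())
size-nonZero sq  {suc (suc zero)} (s≤s (s≤s ()))

module Main (g : Grid) (n : ℕ) (I : RuleSet) (valid : ValidSize g n)
            (x : Config g n) (u : Cell g n) (inactive : x u ≡ false) where
  open Counting
  open Dynamics g {n}
  open Shadow g {n} I

  private instance
    size≢0 : NonZero (size g n)
    size≢0 = size-nonZero g valid

  -- at u the F*-run either copies the F-run or is inactive
  stable-F⇒F* : Stable g n I x u → Stable g n (Star g I) x u
  stable-F⇒F* stable σ sched t with shadow-run σ x t u
  ... | inj₁ same      = trans (sym same) (stable σ sched t)
  ... | inj₂ (off , _) = trans off (sym inactive)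

  activity : (ℕ → Cell g n) → ℕ → ℕ
  activity σ t = activeSum g (run g (Star g I) σ x t) u

  activity-climbs : ∀ σ t → activity σ (suc t) ≤ suc (activity σ t)
  activity-climbs σ t = activeSum-step valid (Star g I) (run g (Star g I) σ x t) (σ t) u

  -- if u became active under F, its F*-neighbourhood would be full, so on its way up the
  -- activity passed through [k₁, k] ⊆ 𝓘_{F*}, which silence forbids
  stable-F*⇒F : ∀ {k₁ k} → k₁ ≤ k → k < deg g → (∀ {s} → k₁ ≤ s → s ≤ k → Star g I s ≡ true) →
    activeSum g x u ≤ k → Stable g n (Star g I) x u → Stable g n I x u
  stable-F*⇒F {k₁} {k} k₁≤k k<deg filled start stable* σ sched t with shadow-run σ x t u
  ... | inj₁ same      = trans same (stable* σ sched t)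
  ... | inj₂ (_ , sat) with intermediate-value (activity σ) start k₁≤k (activity-climbs σ) t
        (≤-trans (<⇒≤ (≤-<-trans k₁≤k k<deg)) (≤-reflexive (sym (all⇒count≡length _ (nbrs g u) sat))))
  ...   | q , k₁≤aq , aq≤k =
    contradiction (trans (sym (filled k₁≤aq aq≤k))
                         (Silence.silent g n (Star g I) x u inactive stable* σ sched q)) λ ()

lemma5 : (g : Grid) (n : ℕ) (I : RuleSet) → ValidSize g n → IsLifeLikeInterval g I →
    (x : Config g n) (u : Cell g n) → x u ≡ false →
    (∃ λ k → Star g I k ≡ true × activeSum g x u ≤ k) →
    (Stable g n I x u ⇔ Stable g n (Star g I) x u)
lemma5 g n I valid interval x u inactive (k , k∈ , start)
  with StarRule.Star-interval g I interval k∈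
... | k₁ , k₁≤k , k<deg , filled =
  mk⇔ stable-F⇒F* (stable-F*⇒F k₁≤k k<deg filled start)
  where open Main g n I valid x u inactive
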